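{- Let $\langle\mathbf{A}_{\mathrm d},\mathbf{A},\iota\rangle$ be a distributively generated (generalized) additive quantale with multiplication, regarded as an $\mathbf{A}$-module via $a\ast x:=a\cdot x$, and let $\gamma$ be a structural nucleus on this $\mathbf{A}$-module. Then $\mathbf{A}_\gamma$ is a cyclic $\mathbf{A}$-module with cyclic generator $\gamma(\mathsf1)$.
   Context: Fix one of two parallel settings: plain ("joins" = joins of arbitrary families) or generalized ("joins" = joins of non-empty families). A (generalized) quantale is $\langle Q,\bigvee,+,\mathsf{0}\rangle$ with $Q$ a poset having all such joins, $\langle Q,+,\mathsf{0}\rangle$ a monoid with $+$ order-preserving and distributing over such joins on both sides. A (generalized) additive quantale with multiplication is a triple $\langle\mathbf{A}_{\mathrm d},\mathbf{A},\iota\rangle$: $\mathbf{A}_{\mathrm d}$ a monoid, $\mathbf{A}$ a (generalized) quantale with an additional monoid structure $\langle A,\cdot,\mathsf 1\rangle$, $\iota$ a monoid homomorphism, such that $(\bigvee_i a_i)\cdot b=\bigvee_i(a_i\cdot b)$, $(a+b)\cdot c=a\cdot c+b\cdot c$, $\mathsf0\cdot a=\mathsf0$, and for $d\in\mathbf{A}_{\mathrm d}$ left multiplication by $\iota(d)$ preserves joins, $+$, $\mathsf0$; distributively generated means $\mathbf{A}$ is generated as a (generalized) quantale by $\iota[\mathbf{A}_{\mathrm d}]$. An $\mathbf{A}$-module is a (generalized) quantale $\mathbf{Q}$ with $\ast\colon A\times Q\to Q$, order-preserving in both coordinates, with $(a\cdot b)\ast x=a\ast(b\ast x)$, $\mathsf1\ast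 x=x$, $(a+b)\ast x=a\ast x+b\ast x$, $\mathsf0\ast x=\mathsf0$, $(\bigvee_i a_i)\ast x=\bigvee_i(a_i\ast x)$, and $x\mapsto\iota(d)\ast x$ preserving $+$, $\mathsf0$, joins for $d\in\mathbf{A}_{\mathrm d}$. A structural nucleus on a module $\mathbf{Q}$ is an order-preserving, expansive, idempotent $\gamma\colon Q\to Q$ with $\gamma(x)+\gamma(y)\leq\gamma(x+y)$ and $a\ast\gamma(x)\leq\gamma(a\ast x)$ for all $a\in A$. $\mathbf{Q}_\gamma$ is the module on $\gamma[Q]$ with $\bigvee_\gamma X=\gamma(\bigvee X)$, $x+_\gamma y=\gamma(x+y)$, $\mathsf0_\gamma=\gamma(\mathsf0)$, $a\ast_\gamma x=\gamma(a\ast x)$. A module $\mathbf{Q}$ is cyclic with cyclic generator $u$ if $Q=\{a\ast u:a\in A\}$. -}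

module Defs where

open import Level using (Level; _⊔_; suc)
open import Data.Unit.Polymorphic using (⊤)
open import Data.Product using (Σ; ∃; _,_; proj₁; _×_)
open import Relation.Binary.PropositionalEquality using (_≡_)
open import Relation.Binary.Structures using (IsPartialOrder)
open import Algebra.Structures using (IsMonoid)

-- The two parallel settings.
-- plain       : joins of arbitrary families
-- generalized : joins of non-empty families
-- A family is indexed by a type I : Set ℓ; for the generalized setting
-- an inhabitant of I must be supplied (non-emptiness).

data Setting : Set where
  plain generalized : Setting

Admissible : ∀ {ℓ} → Setting → Set ℓ → Set ℓ
Admissible plain       I = ⊤
Admissible generalized I = I

JoinOp : ∀ {c} (s : Setting) (ℓ : Level) → Set c → Set (c ⊔ suc ℓ)
JoinOp s ℓ Q = {I : Set ℓ} → Admissible s I → (I → Q) → Q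

record IsQuantale (s : Setting) {c r ℓ : Level} {Q : Set c}
                  (_≤_ : Q → Q → Set r) (⋁ : JoinOp s ℓ Q)
                  (_+_ : Q → Q → Q) (𝟘 : Q) : Set (c ⊔ r ⊔ suc ℓ) where
  field
    isPartialOrder : IsPartialOrder _≡_ _≤_
    ⋁-upper        : ∀ {I : Set ℓ} (ne : Admissible s I) (f : I → Q) (i : I) →
                     f i ≤ ⋁ ne f
    ⋁-least        : ∀ {I : Set ℓ} (ne : Admissible s I) (f : I → Q) (x : Q) →
                     (∀ i → f i ≤ x) → ⋁ ne f ≤ x
    +-isMonoid     : IsMonoid _≡_ _+_ 𝟘
    +-mono         : ∀ {x x′ y y′} → x ≤ x′ → y ≤ y′ → (x + y) ≤ (x′ + y′)
    +-distribˡ-⋁   : ∀ {I : Set ℓ} (ne : Admissible s I) (f : I → Q) (x : Q) →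
                     x + ⋁ ne f ≡ ⋁ ne (λ i → x + f i)
    +-distribʳ-⋁   : ∀ {I : Set ℓ} (ne : Admissible s I) (f : I → Q) (x : Q) →
                     ⋁ ne f + x ≡ ⋁ ne (λ i → f i + x)

record AQM (s : Setting) (d c r ℓ : Level) : Set (suc (d ⊔ c ⊔ r ⊔ ℓ)) where
  infixl 7 _·_ _∙_
  infixl 6 _+_
  infix 4 _≤_
  field
    D           : Set d
    _∙_         : D → D → D
    ε           : D
    D-isMonoid  : IsMonoid _≡_ _∙_ ε
    A           : Set c
    _≤_         : A → A → Set r
    ⋁           : JoinOp s ℓ A
    _+_         : A → A → A
    𝟘           : A
    isQuantale  : IsQuantale s _≤_ ⋁ _+_ 𝟘
    _·_         : A → A → A
    𝟙           : A
    ·-isMonoid  : IsMonoid _≡_ _·_ 𝟙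
    ι           : D → A
    ι-∙         : ∀ d e → ι (d ∙ e) ≡ ι d · ι e
    ι-ε         : ι ε ≡ 𝟙
    ·-distribʳ-⋁ : ∀ {I : Set ℓ} (ne : Admissible s I) (f : I → A) (b : A) →
                   ⋁ ne f · b ≡ ⋁ ne (λ i → f i · b)
    ·-distribʳ-+ : ∀ a b c′ → (a + b) · c′ ≡ a · c′ + b · c′
    ·-zeroˡ      : ∀ a → 𝟘 · a ≡ 𝟘
    ι-distribˡ-⋁ : ∀ (x : D) {I : Set ℓ} (ne : Admissible s I) (f : I → A) →
                   ι x · ⋁ ne f ≡ ⋁ ne (λ i → ι x · f i)
    ι-distribˡ-+ : ∀ (x : D) a b → ι x · (a + b) ≡ ι x · a + ι x · b
    ι-zeroʳ      : ∀ (x : D) → ι x · 𝟘 ≡ 𝟘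

module _ {s d c r ℓ} (𝔸 : AQM s d c r ℓ) where
  open AQM 𝔸

  data Generated : A → Set (d ⊔ c ⊔ suc ℓ) where
    gen-ι : ∀ x → Generated (ι x)
    gen-𝟘 : Generated 𝟘
    gen-+ : ∀ {a b} → Generated a → Generated b → Generated (a + b)
    gen-⋁ : ∀ {I : Set ℓ} (ne : Admissible s I) (f : I → A) →
            (∀ i → Generated (f i)) → Generated (⋁ ne f)

  DistributivelyGenerated : Set (d ⊔ c ⊔ suc ℓ)
  DistributivelyGenerated = ∀ a → Generated a

module _ {s d c r ℓ} (𝔸 : AQM s d c r ℓ) where
  private module 𝔸 = AQM 𝔸

  record IsModule {q r′} {Q : Set q} (_≤_ : Q → Q → Set r′) (⋁ : JoinOp s ℓ Q)
                  (_+_ : Q → Q → Q) (𝟘 : Q) (_∗_ : 𝔸.A → Q → Q)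
                  : Set (d ⊔ c ⊔ r ⊔ q ⊔ r′ ⊔ suc ℓ) where
    field
      isQuantale : IsQuantale s _≤_ ⋁ _+_ 𝟘
      ∗-mono     : ∀ {a a′ x x′} → a 𝔸.≤ a′ → x ≤ x′ → (a ∗ x) ≤ (a′ ∗ x′)
      ∗-assoc    : ∀ a b x → (a 𝔸.· b) ∗ x ≡ a ∗ (b ∗ x)
      ∗-identity : ∀ x → 𝔸.𝟙 ∗ x ≡ x
      +-∗        : ∀ a b x → (a 𝔸.+ b) ∗ x ≡ (a ∗ x) + (b ∗ x)
      𝟘-∗        : ∀ x → 𝔸.𝟘 ∗ x ≡ 𝟘
      ⋁-∗        : ∀ {I : Set ℓ} (ne : Admissible s I) (f : I → 𝔸.A) (x : Q) →
                   (𝔸.⋁ ne f) ∗ x ≡ ⋁ ne (λ i → f i ∗ x)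
      ι-∗-+      : ∀ (e : 𝔸.D) x y → 𝔸.ι e ∗ (x + y) ≡ (𝔸.ι e ∗ x) + (𝔸.ι e ∗ y)
      ι-∗-𝟘      : ∀ (e : 𝔸.D) → 𝔸.ι e ∗ 𝟘 ≡ 𝟘
      ι-∗-⋁      : ∀ (e : 𝔸.D) {I : Set ℓ} (ne : Admissible s I) (f : I → Q) →
                   𝔸.ι e ∗ ⋁ ne f ≡ ⋁ ne (λ i → 𝔸.ι e ∗ f i)

  IsCyclic : ∀ {q} {Q : Set q} (_∗_ : 𝔸.A → Q → Q) (u : Q) → Set (c ⊔ q)
  IsCyclic {Q = Q} _∗_ u = ∀ (x : Q) → ∃ λ (a : 𝔸.A) → x ≡ a ∗ u

  record IsCyclicModule {q r′} {Q : Set q} (_≤_ : Q → Q → Set r′) (⋁ : JoinOp s ℓ Q)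
                        (_+_ : Q → Q → Q) (𝟘 : Q) (_∗_ : 𝔸.A → Q → Q) (u : Q)
                        : Set (d ⊔ c ⊔ r ⊔ q ⊔ r′ ⊔ suc ℓ) where
    field
      isModule : IsModule _≤_ ⋁ _+_ 𝟘 _∗_
      cyclic   : IsCyclic _∗_ u

record IsStructuralNucleus {c q r′ : Level} {A : Set c} {Q : Set q}
                           (_≤_ : Q → Q → Set r′) (_+_ : Q → Q → Q)
                           (_∗_ : A → Q → Q) (γ : Q → Q) : Set (c ⊔ q ⊔ r′) where
  field
    mono      : ∀ {x y} → x ≤ y → γ x ≤ γ y
    expansive : ∀ x → x ≤ γ x
    idem      : ∀ x → γ (γ x) ≡ γ x
    +-lax     : ∀ x y → (γ x + γ y) ≤ γ (x + y)
    ∗-lax     : ∀ a x → (a ∗ γ x) ≤ γ (a ∗ x)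

-- The structure Q_γ on γ[Q], represented as the fixed points of γ
-- (for an idempotent γ, γ[Q] = { x : γ x ≡ x }).

module Nucleic {s : Setting} {ℓ c q r′ : Level} {A : Set c} {Q : Set q}
               (_≤_ : Q → Q → Set r′) (⋁ : JoinOp s ℓ Q)
               (_+_ : Q → Q → Q) (𝟘 : Q) (_∗_ : A → Q → Q)
               (γ : Q → Q) (idem : ∀ x → γ (γ x) ≡ γ x) where

  Fix : Set q
  Fix = Σ Q (λ x → γ x ≡ x)

  η : Q → Fix
  η x = γ x , idem x

  _≤γ_ : Fix → Fix → Set r′
  x ≤γ y = proj₁ x ≤ proj₁ y

  ⋁γ : JoinOp s ℓ Fix
  ⋁γ ne f = η (⋁ ne (λ i → proj₁ (f i)))

  _+γ_ : Fix → Fix → Fix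
  x +γ y = η (proj₁ x + proj₁ y)

  𝟘γ : Fix
  𝟘γ = η 𝟘

  _∗γ_ : A → Fix → Fix
  a ∗γ x = η (a ∗ proj₁ x)

module Submission where

-- Acting on itself by multiplication, A is an A-module with cyclic
-- generator 𝟙; the only axiom that is not immediate is monotonicity of a · _,
-- which holds for a = ι e because ι e · _ preserves joins, and then for every a
-- by induction on how a is generated from ι[A_d].  For any structural nucleus
-- γ on any module Q, the fixed points Q_γ again form a module, because γ
-- absorbs inner applications of itself: γ (γ x + y) = γ (x + y),
-- γ (⋁ (γ ∘ f)) = γ (⋁ f) and γ (a ∗ γ x) = γ (a ∗ x).  The last identity also
-- shows that γ u generates Q_γ whenever u generates Q.

open import Defs
open import Level using (Lift; lift)
open import Function using (_∘_)
open import Data.Bool using (Bool; true; false)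
open import Data.Unit.Polymorphic using (tt)
open import Data.Product using (_,_; proj₁; proj₂)
open import Data.Product.Properties using (Σ-≡,≡→≡)
open import Axiom.UniquenessOfIdentityProofs.WithK using (uip)
open import Relation.Binary.PropositionalEquality
  using (_≡_; refl; sym; trans; cong; cong₂; isEquivalence)
open import Relation.Binary.Structures using (IsPartialOrder)
open import Algebra.Structures using (IsMonoid)

-- Both settings admit two-element families, which turn joins into binary joins.
pairIndex : ∀ {ℓ} (s : Setting) → Admissible s (Lift ℓ Bool)
pairIndex plain       = tt
pairIndex generalized = lift true

module QuantaleProperties {s c r ℓ} {Q : Set c} {_≤_ : Q → Q → Set r}
                          {⋁ : JoinOp s ℓ Q} {_+_ : Q → Q → Q} {𝟘 : Q}
                          (isQuantale : IsQuantale s _≤_ ⋁ _+_ 𝟘) where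
  open IsQuantale isQuantale
  open IsPartialOrder isPartialOrder public using (antisym)
    renaming (refl to ≤-refl; trans to ≤-trans; reflexive to ≤-reflexive)

  pair : Q → Q → Lift ℓ Bool → Q
  pair x y (lift true)  = x
  pair x y (lift false) = y

  ⋁-pair : ∀ {x y} → x ≤ y → ⋁ (pairIndex s) (pair x y) ≡ y
  ⋁-pair {x} {y} x≤y = antisym
    (⋁-least (pairIndex s) _ y λ { (lift true) → x≤y ; (lift false) → ≤-refl })
    (⋁-upper (pairIndex s) (pair x y) (lift false))

  ⋁-preserving⇒monotone : (h : Q → Q) →
    (∀ {I : Set ℓ} (ne : Admissible s I) (f : I → Q) → h (⋁ ne f) ≡ ⋁ ne (h ∘ f)) →
    ∀ {x y} → x ≤ y → h x ≤ h y
  ⋁-preserving⇒monotone h h-⋁ {x} {y} x≤y =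
    ≤-trans (⋁-upper (pairIndex s) (h ∘ pair x y) (lift true))
            (≤-reflexive (trans (sym (h-⋁ (pairIndex s) (pair x y))) (cong h (⋁-pair x≤y))))

module NucleusProperties {s c q r ℓ} {A : Set c} {Q : Set q} {_≤_ : Q → Q → Set r}
                         {⋁ : JoinOp s ℓ Q} {_+_ : Q → Q → Q} {𝟘 : Q}
                         (isQuantale : IsQuantale s _≤_ ⋁ _+_ 𝟘)
                         {_∗_ : A → Q → Q} {γ : Q → Q}
                         (nuc : IsStructuralNucleus _≤_ _+_ _∗_ γ) where
  open IsQuantale isQuantale
  open QuantaleProperties isQuantale
  open IsStructuralNucleus nuc
  open Nucleic _≤_ ⋁ _+_ 𝟘 _∗_ γ idem

  Fix-≡ : ∀ {x y : Fix} → proj₁ x ≡ proj₁ y → x ≡ y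
  Fix-≡ p = Σ-≡,≡→≡ (p , uip _ _)

  γ-least : ∀ {x y} → x ≤ γ y → γ x ≤ γ y
  γ-least {x} {y} x≤γy = ≤-trans (mono x≤γy) (≤-reflexive (idem y))

  γ-≡ : ∀ {x y} → x ≤ γ y → y ≤ γ x → γ x ≡ γ y
  γ-≡ x≤γy y≤γx = antisym (γ-least x≤γy) (γ-least y≤γx)

  γ-absorbˡ-+ : ∀ x y → γ (γ x + y) ≡ γ (x + y)
  γ-absorbˡ-+ x y = γ-≡ (≤-trans (+-mono ≤-refl (expansive y)) (+-lax x y))
                        (≤-trans (+-mono (expansive x) ≤-refl) (expansive _))

  γ-absorbʳ-+ : ∀ x y → γ (x + γ y) ≡ γ (x + y)
  γ-absorbʳ-+ x y = γ-≡ (≤-trans (+-mono (expansive x) ≤-refl) (+-lax x y))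
                        (≤-trans (+-mono ≤-refl (expansive y)) (expansive _))

  γ-absorb-+ : ∀ x y → γ (γ x + γ y) ≡ γ (x + y)
  γ-absorb-+ x y = trans (γ-absorbˡ-+ x (γ y)) (γ-absorbʳ-+ x y)

  γ-absorb-⋁ : ∀ {I : Set ℓ} (ne : Admissible s I) (f : I → Q) →
               γ (⋁ ne (γ ∘ f)) ≡ γ (⋁ ne f)
  γ-absorb-⋁ ne f = γ-≡
    (⋁-least ne _ _ (λ i → mono (⋁-upper ne f i)))
    (≤-trans (⋁-least ne f _ (λ i → ≤-trans (expansive (f i)) (⋁-upper ne (γ ∘ f) i)))
             (expansive _))

  γ-absorb-∗ : (∀ a {x y} → x ≤ y → (a ∗ x) ≤ (a ∗ y)) → ∀ a x → γ (a ∗ γ x) ≡ γ (a ∗ x)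
  γ-absorb-∗ ∗-monoʳ a x = γ-≡ (∗-lax a x) (≤-trans (∗-monoʳ a (expansive x)) (expansive _))

  Fix-isPartialOrder : IsPartialOrder _≡_ _≤γ_
  Fix-isPartialOrder = record
    { isPreorder = record
      { isEquivalence = isEquivalence
      ; reflexive     = λ { refl → ≤-refl }
      ; trans         = ≤-trans
      }
    ; antisym = λ x≤y y≤x → Fix-≡ (antisym x≤y y≤x)
    }

  Fix-+-isMonoid : IsMonoid _≡_ _+γ_ 𝟘γ
  Fix-+-isMonoid = record
    { isSemigroup = record
      { isMagma = record { isEquivalence = isEquivalence ; ∙-cong = cong₂ _+γ_ }
      ; assoc   = λ x y z → Fix-≡ (trans (γ-absorbˡ-+ _ _)
                     (trans (cong γ (+.assoc _ _ _)) (sym (γ-absorbʳ-+ _ _))))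
      }
    ; identity =
        (λ x → Fix-≡ (trans (γ-absorbˡ-+ _ _) (trans (cong γ (+.identityˡ _)) (proj₂ x))))
      , (λ x → Fix-≡ (trans (γ-absorbʳ-+ _ _) (trans (cong γ (+.identityʳ _)) (proj₂ x))))
    }
    where module + = IsMonoid +-isMonoid

  Fix-isQuantale : IsQuantale s _≤γ_ ⋁γ _+γ_ 𝟘γ
  Fix-isQuantale = record
    { isPartialOrder = Fix-isPartialOrder
    ; ⋁-upper        = λ ne f i → ≤-trans (⋁-upper ne (proj₁ ∘ f) i) (expansive _)
    ; ⋁-least        = λ ne f x fi≤x → ≤-trans (mono (⋁-least ne _ _ fi≤x)) (≤-reflexive (proj₂ x))
    ; +-isMonoid     = Fix-+-isMonoid
    ; +-mono         = λ x≤x′ y≤y′ → mono (+-mono x≤x′ y≤y′)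
    ; +-distribˡ-⋁   = λ ne f x → Fix-≡ (trans (γ-absorbʳ-+ _ _)
                          (trans (cong γ (+-distribˡ-⋁ ne _ _)) (sym (γ-absorb-⋁ ne _))))
    ; +-distribʳ-⋁   = λ ne f x → Fix-≡ (trans (γ-absorbˡ-+ _ _)
                          (trans (cong γ (+-distribʳ-⋁ ne _ _)) (sym (γ-absorb-⋁ ne _))))
    }

module _ {s d c r ℓ} (𝔸 : AQM s d c r ℓ) where
  open AQM 𝔸

  module NucleicModule {q r′} {Q : Set q} {_≼_ : Q → Q → Set r′} {⋁Q : JoinOp s ℓ Q}
                          {_⊕_ : Q → Q → Q} {𝟘Q : Q} {_∗_ : A → Q → Q}
                          (isModule : IsModule 𝔸 _≼_ ⋁Q _⊕_ 𝟘Q _∗_)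
                          {γ : Q → Q} (nuc : IsStructuralNucleus _≼_ _⊕_ _∗_ γ) where
    open IsModule isModule renaming (isQuantale to Q-isQuantale)
    open NucleusProperties Q-isQuantale nuc
    open IsStructuralNucleus nuc
    open Nucleic _≼_ ⋁Q _⊕_ 𝟘Q _∗_ γ idem
    open QuantaleProperties (AQM.isQuantale 𝔸) using () renaming (≤-refl to ≤A-refl)

    ∗-monoʳ : ∀ a {x y} → x ≼ y → (a ∗ x) ≼ (a ∗ y)
    ∗-monoʳ a = ∗-mono ≤A-refl

    Fix-isModule : IsModule 𝔸 _≤γ_ ⋁γ _+γ_ 𝟘γ _∗γ_
    Fix-isModule = record
      { isQuantale = Fix-isQuantale
      ; ∗-mono     = λ a≤a′ x≤x′ → mono (∗-mono a≤a′ x≤x′)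
      ; ∗-assoc    = λ a b x → Fix-≡ (trans (cong γ (∗-assoc _ _ _)) (sym (γ-absorb-∗ ∗-monoʳ _ _)))
      ; ∗-identity = λ x → Fix-≡ (trans (cong γ (∗-identity _)) (proj₂ x))
      ; +-∗        = λ a b x → Fix-≡ (trans (cong γ (+-∗ _ _ _)) (sym (γ-absorb-+ _ _)))
      ; 𝟘-∗        = λ x → Fix-≡ (cong γ (𝟘-∗ _))
      ; ⋁-∗        = λ ne f x → Fix-≡ (trans (cong γ (⋁-∗ ne _ _)) (sym (γ-absorb-⋁ ne _)))
      ; ι-∗-+      = λ e x y → Fix-≡ (trans (γ-absorb-∗ ∗-monoʳ _ _)
                        (trans (cong γ (ι-∗-+ e _ _)) (sym (γ-absorb-+ _ _))))
      ; ι-∗-𝟘      = λ e → Fix-≡ (trans (γ-absorb-∗ ∗-monoʳ _ _) (cong γ (ι-∗-𝟘 e)))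
      ; ι-∗-⋁      = λ e ne f → Fix-≡ (trans (γ-absorb-∗ ∗-monoʳ _ _)
                        (trans (cong γ (ι-∗-⋁ e ne _)) (sym (γ-absorb-⋁ ne _))))
      }

    Fix-isCyclic : ∀ {u} → IsCyclic 𝔸 _∗_ u → IsCyclic 𝔸 _∗γ_ (η u)
    Fix-isCyclic {u} cyclic (x , γx≡x) with cyclic x
    ... | a , x≡a∗u = a , Fix-≡ (trans (sym γx≡x) (trans (cong γ x≡a∗u) (sym (γ-absorb-∗ ∗-monoʳ a u))))

  module RegularModule (dg : DistributivelyGenerated 𝔸) where
    open IsQuantale isQuantale
    open QuantaleProperties isQuantale
    private module · = IsMonoid ·-isMonoid

    ·-monoˡ : ∀ {a a′} b → a ≤ a′ → a · b ≤ a′ · b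
    ·-monoˡ b = ⋁-preserving⇒monotone (_· b) (λ ne f → ·-distribʳ-⋁ ne f b)

    ·-monoʳ-generated : ∀ {a} → Generated 𝔸 a → ∀ {x y} → x ≤ y → a · x ≤ a · y
    ·-monoʳ-generated (gen-ι e) = ⋁-preserving⇒monotone (ι e ·_) (ι-distribˡ-⋁ e)
    ·-monoʳ-generated gen-𝟘 {x} {y} _ = ≤-reflexive (trans (·-zeroˡ x) (sym (·-zeroˡ y)))
    ·-monoʳ-generated (gen-+ {a} {b} ga gb) {x} {y} x≤y =
      ≤-trans (≤-reflexive (·-distribʳ-+ a b x))
      (≤-trans (+-mono (·-monoʳ-generated ga x≤y) (·-monoʳ-generated gb x≤y))
               (≤-reflexive (sym (·-distribʳ-+ a b y))))
    ·-monoʳ-generated (gen-⋁ ne f gf) {x} {y} x≤y =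
      ≤-trans (≤-reflexive (·-distribʳ-⋁ ne f x))
      (≤-trans (⋁-least ne _ _ (λ i → ≤-trans (·-monoʳ-generated (gf i) x≤y)
                                               (⋁-upper ne (λ j → f j · y) i)))
               (≤-reflexive (sym (·-distribʳ-⋁ ne f y))))

    ·-monoʳ : ∀ a {x y} → x ≤ y → a · x ≤ a · y
    ·-monoʳ a = ·-monoʳ-generated (dg a)

    ·-isModule : IsModule 𝔸 _≤_ ⋁ _+_ 𝟘 _·_
    ·-isModule = record
      { isQuantale = isQuantale
      ; ∗-mono     = λ {a} {a′} {x} a≤a′ x≤x′ → ≤-trans (·-monoˡ x a≤a′) (·-monoʳ a′ x≤x′)
      ; ∗-assoc    = ·.assoc
      ; ∗-identity = ·.identityˡ
      ; +-∗        = ·-distribʳ-+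
      ; 𝟘-∗        = ·-zeroˡ
      ; ⋁-∗        = ·-distribʳ-⋁
      ; ι-∗-+      = ι-distribˡ-+
      ; ι-∗-𝟘      = ι-zeroʳ
      ; ι-∗-⋁      = ι-distribˡ-⋁
      }

    ·-isCyclic : IsCyclic 𝔸 _·_ 𝟙
    ·-isCyclic a = a , sym (·.identityʳ a)

lemma6p5 : ∀ {s d c r ℓ} (𝔸 : AQM s d c r ℓ) → DistributivelyGenerated 𝔸 →
           (γ : AQM.A 𝔸 → AQM.A 𝔸) →
           (nuc : IsStructuralNucleus (AQM._≤_ 𝔸) (AQM._+_ 𝔸) (AQM._·_ 𝔸) γ) →
           IsCyclicModule 𝔸
             (Nucleic._≤γ_ (AQM._≤_ 𝔸) (AQM.⋁ 𝔸) (AQM._+_ 𝔸) (AQM.𝟘 𝔸) (AQM._·_ 𝔸) γ (IsStructuralNucleus.idem nuc))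
             (Nucleic.⋁γ (AQM._≤_ 𝔸) (AQM.⋁ 𝔸) (AQM._+_ 𝔸) (AQM.𝟘 𝔸) (AQM._·_ 𝔸) γ (IsStructuralNucleus.idem nuc))
             (Nucleic._+γ_ (AQM._≤_ 𝔸) (AQM.⋁ 𝔸) (AQM._+_ 𝔸) (AQM.𝟘 𝔸) (AQM._·_ 𝔸) γ (IsStructuralNucleus.idem nuc))
             (Nucleic.𝟘γ (AQM._≤_ 𝔸) (AQM.⋁ 𝔸) (AQM._+_ 𝔸) (AQM.𝟘 𝔸) (AQM._·_ 𝔸) γ (IsStructuralNucleus.idem nuc))
             (Nucleic._∗γ_ (AQM._≤_ 𝔸) (AQM.⋁ 𝔸) (AQM._+_ 𝔸) (AQM.𝟘 𝔸) (AQM._·_ 𝔸) γ (IsStructuralNucleus.idem nuc))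
             (Nucleic.η (AQM._≤_ 𝔸) (AQM.⋁ 𝔸) (AQM._+_ 𝔸) (AQM.𝟘 𝔸) (AQM._·_ 𝔸) γ (IsStructuralNucleus.idem nuc) (AQM.𝟙 𝔸))
lemma6p5 𝔸 dg γ nuc = record
  { isModule = Fix-isModule
  ; cyclic   = Fix-isCyclic ·-isCyclic
  }
  where
    open RegularModule 𝔸 dg
    open NucleicModule 𝔸 ·-isModule nuc
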